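{- Let $n\geq1$ and let $\mathcal{H}$ be a non-empty hereditary sub-family of $2^{[n]}$ such that some element $x$ belongs to every base of $\mathcal{H}$. Let $\mathcal{S}$ be a largest star of $\mathcal{H}$. Then: (1) for every $k\geq n+1$, the maximum of $\sum_{i=1}^k|\mathcal{A}_i|$ over all $k$-tuples of cross-intersecting sub-families $\mathcal{A}_1,\dots,\mathcal{A}_k$ of $\mathcal{H}$ is attained by $\mathcal{A}_1=\dots=\mathcal{A}_k=\mathcal{S}$ (i.e. equals $k|\mathcal{S}|$); (2) for every integer $k\geq1$: if $k\leq|\mathcal{H}|/|\mathcal{S}|$, then the maximum of $\sum_{i=1}^k|\mathcal{A}_i|$ over all cross-intersecting sub-families $\mathcal{A}_1,\dots,\mathcal{A}_k$ of $\mathcal{H}$ is attained by $\mathcal{A}_1=\mathcal{H}$, $\mathcal{A}_2=\dots=\mathcal{A}_k=\emptyset$ (i.e. equals $|\mathcal{H}|$); and if $k\geq|\mathcal{H}|/|\mathcal{S}|$, then this maximum is attained by $\mathcal{A}_1=\dots=\mathcal{A}_k=\mathcal{S}$ (i.e. equals $k|\mathcal{S}|$); (3) for every $k\geq2$, the maximum of $\prod_{i=1}^k|\mathcal{A}_i|$ over all cross-intersecting sub-families $\mathcal{A}_1,\dots,\mathcal{A}_k$ of $\mathcal{H}$ is attained by $\mathcal{A}_1=\dots=\mathcal{A}_k=\mathcal{S}$ (i.e. equals $|\mathcal{S}|^k$).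
   Context: $[n]=\{1,\dots,n\}$. A family $\mathcal{H}$ is hereditary if all subsets of any set in $\mathcal{H}$ are in $\mathcal{H}$. A base of $\mathcal{H}$ is a set in $\mathcal{H}$ not properly contained in any other set in $\mathcal{H}$. For $y\in[n]$, the star $\mathcal{H}\langle y\rangle=\{H\in\mathcal{H}:y\in H\}$; a largest star is one of maximum size. Families $\mathcal{A}_1,\dots,\mathcal{A}_k$ (not necessarily distinct or non-empty) are cross-intersecting if for all $i\neq j$, every set in $\mathcal{A}_i$ intersects every set in $\mathcal{A}_j$. -}

module Defs where

open import Data.Bool using (Bool; true; false; _∧_; if_then_else_)
open import Data.Nat using (ℕ; zero; suc; _+_; _*_)
open import Data.Fin using (Fin; zero; suc; _≟_)
open import Data.Fin.Subset using (Subset; _∈_; _⊆_; _∩_; Nonempty; inside; outside)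
open import Data.Vec using (_∷_; [])
open import Data.List using (List; []; _∷_; map; _++_)
open import Data.Product using (Σ; ∃; _×_)
open import Relation.Binary.PropositionalEquality using (_≡_; _≢_)
open import Relation.Nullary.Decidable using (⌊_⌋)

-- A family of subsets of [n] = Fin n, given by its (decidable) membership predicate.
Family : ℕ → Set
Family n = Subset n → Bool

_∈F_ : ∀ {n} → Subset n → Family n → Set
S ∈F 𝓗 = 𝓗 S ≡ true

allSubsets : (n : ℕ) → List (Subset n)
allSubsets zero = [] ∷ []
allSubsets (suc n) = map (inside ∷_) (allSubsets n) ++ map (outside ∷_) (allSubsets n)

countTrue : List Bool → ℕ
countTrue [] = 0
countTrue (true ∷ bs) = suc (countTrue bs)
countTrue (false ∷ bs) = countTrue bs

card : ∀ {n} → Family n → ℕ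
card {n} 𝓗 = countTrue (map 𝓗 (allSubsets n))

_⊆F_ : ∀ {n} → Family n → Family n → Set
𝓐 ⊆F 𝓗 = ∀ S → S ∈F 𝓐 → S ∈F 𝓗

Hereditary : ∀ {n} → Family n → Set
Hereditary 𝓗 = ∀ S T → S ∈F 𝓗 → T ⊆ S → T ∈F 𝓗

NonemptyFam : ∀ {n} → Family n → Set
NonemptyFam 𝓗 = ∃ λ S → S ∈F 𝓗

IsBase : ∀ {n} → Family n → Subset n → Set
IsBase 𝓗 B = B ∈F 𝓗 × (∀ S → S ∈F 𝓗 → B ⊆ S → S ≡ B)

_∈?_ : ∀ {n} → Fin n → Subset n → Bool
zero ∈? (b ∷ _) = b
suc i ∈? (_ ∷ p) = i ∈? p

star : ∀ {n} → Family n → Fin n → Family n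
star 𝓗 y S = 𝓗 S ∧ (y ∈? S)

IsLargestStar : ∀ {n} → Family n → Fin n → Set
IsLargestStar 𝓗 y = ∀ z → card (star 𝓗 z) Data.Nat.≤ card (star 𝓗 y)

emptyFam : ∀ {n} → Family n
emptyFam _ = false

CrossIntersecting : ∀ {n k} → (Fin k → Family n) → Set
CrossIntersecting {n} {k} 𝓐 =
  ∀ (i j : Fin k) → i ≢ j → ∀ A B → A ∈F 𝓐 i → B ∈F 𝓐 j → Nonempty (A ∩ B)

AllSub : ∀ {n k} → (Fin k → Family n) → Family n → Set
AllSub 𝓐 𝓗 = ∀ i → 𝓐 i ⊆F 𝓗

sumFin : ∀ k → (Fin k → ℕ) → ℕ
sumFin zero f = 0
sumFin (suc k) f = f zero + sumFin k (λ i → f (suc i))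

prodFin : ∀ k → (Fin k → ℕ) → ℕ
prodFin zero f = 1
prodFin (suc k) f = f zero * prodFin k (λ i → f (suc i))

firstOnly : ∀ {n k} → Family n → Fin k → Family n
firstOnly 𝓗 zero = 𝓗
firstOnly 𝓗 (suc _) = emptyFam

-- Two cross-intersecting subfamilies of a hereditary family 𝓗 have total size at most |𝓗|
-- (induction on n, splitting on the first point). Every member of 𝓗 extends to a base, which
-- contains x, so 𝓗 is closed under adding x; hence |𝓗| ≤ 2|𝓗⟨x⟩| ≤ 2s, where s is the size
-- of a largest star. So |𝓐ᵢ| + |𝓐ⱼ| ≤ 2s for i ≠ j, and at most one |𝓐ᵢ| exceeds s: for k ≥ 2
-- this bounds the sum by ks and, by AM-GM on the exceptional pair, the product by sᵏ. For k = 1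
-- the sum is at most |𝓗| trivially.
module Submission where

open import Defs
open import Data.Nat using (ℕ; _≤_; _+_; _*_; _^_)
open import Data.Fin using (Fin)
open import Data.Fin.Subset using (_∈_)
open import Data.Product using (_×_)

import Algebra.Properties.CommutativeSemigroup as CommutativeSemigroupProperties
open import Data.Bool using (Bool; true; false; _∧_; _∨_)
open import Data.Bool.Properties using (∧-conicalˡ; ∧-conicalʳ; ∧-identityʳ; ∨-identityʳ)
  renaming (_≟_ to _≟ᵇ_)
open import Data.Empty using (⊥-elim)
open import Data.Fin using (zero; suc)
import Data.Fin.Properties as Fin
open import Data.Fin.Subset using (Subset; _⊆_; _⊃_; _∩_; _∪_; ⁅_⁆; Nonempty; inside; outside; ∣_∣)
open import Data.Fin.Subset.Properties
  using (drop-there; s⊆s; out⊆; ∉⊥; ⊆-refl; ⊆-trans; ⊆-antisym; _⊂?_; p⊂q⇒p⊆q; p⊂q⇒∣p∣<∣q∣;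
         ∣p∣≤n; x∈⁅y⁆⇒x≡y; x∈p∪q⁻; x∈p∩q⁺; ∪-identityʳ; anySubset?)
  renaming (_∈?_ to _∈ᵈ_)
open import Data.List using (List; []; _∷_; map; _++_)
open import Data.List.Properties using (map-++; map-∘)
open import Data.Nat using (zero; suc; z≤n; s≤s; _<_; _∸_; _⊔_)
open import Data.Nat.Induction using (<-wellFounded)
open import Data.Nat.Properties
open import Data.Product using (∃; _,_; proj₁; proj₂)
open import Data.Sum using (_⊎_; inj₁; inj₂; [_,_]′)
open import Data.Vec using (_∷_; []; here; there)
open import Function using (_∘_)
open import Induction.WellFounded using (WellFounded; Acc; acc; module Subrelation)
import Relation.Binary.Construct.On as On
open import Relation.Binary.PropositionalEquality
open import Relation.Nullary using (yes; no)
open import Relation.Nullary.Decidable using (_×-dec_)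

open CommutativeSemigroupProperties +-commutativeSemigroup using () renaming (interchange to +-interchange)

countTrue-++ : ∀ bs cs → countTrue (bs ++ cs) ≡ countTrue bs + countTrue cs
countTrue-++ [] cs = refl
countTrue-++ (true ∷ bs) cs = cong suc (countTrue-++ bs cs)
countTrue-++ (false ∷ bs) cs = countTrue-++ bs cs

countTrue-map-mono : ∀ {A : Set} {F G : A → Bool} → (∀ a → F a ≡ true → G a ≡ true) →
                     ∀ xs → countTrue (map F xs) ≤ countTrue (map G xs)
countTrue-map-mono F⇒G [] = z≤n
countTrue-map-mono {F = F} {G} F⇒G (x ∷ xs) with F x | G x | F⇒G x
... | true  | true  | _ = s≤s (countTrue-map-mono F⇒G xs)
... | true  | false | Fx⇒Gx with () ← Fx⇒Gx refl
... | false | true  | _ = m≤n⇒m≤1+n (countTrue-map-mono F⇒G xs)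
... | false | false | _ = countTrue-map-mono F⇒G xs

countTrue-map-∨+∧ : ∀ {A : Set} (F G : A → Bool) xs →
  countTrue (map (λ a → F a ∨ G a) xs) + countTrue (map (λ a → F a ∧ G a) xs)
    ≡ countTrue (map F xs) + countTrue (map G xs)
countTrue-map-∨+∧ F G [] = refl
countTrue-map-∨+∧ F G (x ∷ xs) with F x | G x | countTrue-map-∨+∧ F G xs
... | true  | true  | ih = cong suc (trans (+-suc _ _) (trans (cong suc ih) (sym (+-suc _ _))))
... | true  | false | ih = cong suc ih
... | false | true  | ih = trans (cong suc ih) (sym (+-suc _ _))
... | false | false | ih = ih

restrict : ∀ {n} → Bool → Family (suc n) → Family n
restrict b 𝓕 S = 𝓕 (b ∷ S)

_∪F_ _∩F_ : ∀ {n} → Family n → Family n → Family n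
(𝓕 ∪F 𝓖) S = 𝓕 S ∨ 𝓖 S
(𝓕 ∩F 𝓖) S = 𝓕 S ∧ 𝓖 S

card-restrict : ∀ {n} (𝓕 : Family (suc n)) →
                card 𝓕 ≡ card (restrict inside 𝓕) + card (restrict outside 𝓕)
card-restrict {n} 𝓕 = begin
  countTrue (map 𝓕 (map (inside ∷_) L ++ map (outside ∷_) L))
    ≡⟨ cong countTrue (map-++ 𝓕 (map (inside ∷_) L) (map (outside ∷_) L)) ⟩
  countTrue (map 𝓕 (map (inside ∷_) L) ++ map 𝓕 (map (outside ∷_) L))
    ≡⟨ countTrue-++ (map 𝓕 (map (inside ∷_) L)) (map 𝓕 (map (outside ∷_) L)) ⟩
  countTrue (map 𝓕 (map (inside ∷_) L)) + countTrue (map 𝓕 (map (outside ∷_) L))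
    ≡⟨ cong₂ _+_ (cong countTrue (map-∘ L)) (cong countTrue (map-∘ L)) ⟨
  card (restrict inside 𝓕) + card (restrict outside 𝓕) ∎
  where
  open ≡-Reasoning
  L : List (Subset n)
  L = allSubsets n

card-mono : ∀ {n} {𝓕 𝓖 : Family n} → 𝓕 ⊆F 𝓖 → card 𝓕 ≤ card 𝓖
card-mono {n} 𝓕⊆𝓖 = countTrue-map-mono 𝓕⊆𝓖 (allSubsets n)

card-∪F+∩F : ∀ {n} (𝓕 𝓖 : Family n) → card (𝓕 ∪F 𝓖) + card (𝓕 ∩F 𝓖) ≡ card 𝓕 + card 𝓖
card-∪F+∩F {n} 𝓕 𝓖 = countTrue-map-∨+∧ 𝓕 𝓖 (allSubsets n)

∨-true⁻ : ∀ {a b} → a ∨ b ≡ true → a ≡ true ⊎ b ≡ true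
∨-true⁻ {true} _ = inj₁ refl
∨-true⁻ {false} b≡true = inj₂ b≡true

restrict-hereditary : ∀ {n} b {𝓗 : Family (suc n)} → Hereditary 𝓗 → Hereditary (restrict b 𝓗)
restrict-hereditary b her S T S∈ T⊆S = her (b ∷ S) (b ∷ T) S∈ (s⊆s T⊆S)

restrict-inside⊆outside : ∀ {n} {𝓗 : Family (suc n)} → Hereditary 𝓗 →
                          restrict inside 𝓗 ⊆F restrict outside 𝓗
restrict-inside⊆outside her S S∈ = her (inside ∷ S) (outside ∷ S) S∈ (out⊆ ⊆-refl)

Nonempty-drop : ∀ {n} {p : Subset n} → Nonempty (outside ∷ p) → Nonempty p
Nonempty-drop (suc x , x∈) = x , drop-there x∈

CrossIntersecting₂ : ∀ {n} → Family n → Family n → Set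
CrossIntersecting₂ 𝓐 𝓑 = ∀ S T → S ∈F 𝓐 → T ∈F 𝓑 → Nonempty (S ∩ T)

-- Split on the first point: (𝓐₁, 𝓑₁ ∩ 𝓑₀) is cross-intersecting inside 𝓗₁ and (𝓐₀, 𝓑₁ ∪ 𝓑₀)
-- inside 𝓗₀ ⊇ 𝓗₁, while |𝓑₁ ∩ 𝓑₀| + |𝓑₁ ∪ 𝓑₀| = |𝓑₁| + |𝓑₀|.
crossIntersecting₂-card≤ : ∀ {n} {𝓗 𝓐 𝓑 : Family n} → Hereditary 𝓗 → 𝓐 ⊆F 𝓗 → 𝓑 ⊆F 𝓗 →
                           CrossIntersecting₂ 𝓐 𝓑 → card 𝓐 + card 𝓑 ≤ card 𝓗
crossIntersecting₂-card≤ {zero} {𝓗} {𝓐} {𝓑} _ 𝓐⊆𝓗 𝓑⊆𝓗 cross with 𝓐 [] in 𝓐[] | 𝓑 [] in 𝓑[]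
... | true  | true  = ⊥-elim (∉⊥ (proj₂ (cross [] [] 𝓐[] 𝓑[])))
... | true  | false rewrite 𝓐⊆𝓗 [] 𝓐[] = ≤-refl
... | false | true  rewrite 𝓑⊆𝓗 [] 𝓑[] = ≤-refl
... | false | false = z≤n
crossIntersecting₂-card≤ {suc n} {𝓗} {𝓐} {𝓑} her 𝓐⊆𝓗 𝓑⊆𝓗 cross = begin
  card 𝓐 + card 𝓑
    ≡⟨ cong₂ _+_ (card-restrict 𝓐) (card-restrict 𝓑) ⟩
  (card 𝓐₁ + card 𝓐₀) + (card 𝓑₁ + card 𝓑₀)
    ≡⟨ cong ((card 𝓐₁ + card 𝓐₀) +_) (trans (sym (card-∪F+∩F 𝓑₁ 𝓑₀)) (+-comm (card (𝓑₁ ∪F 𝓑₀)) _)) ⟩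
  (card 𝓐₁ + card 𝓐₀) + (card (𝓑₁ ∩F 𝓑₀) + card (𝓑₁ ∪F 𝓑₀))
    ≡⟨ +-interchange (card 𝓐₁) (card 𝓐₀) _ _ ⟩
  (card 𝓐₁ + card (𝓑₁ ∩F 𝓑₀)) + (card 𝓐₀ + card (𝓑₁ ∪F 𝓑₀))
    ≤⟨ +-mono-≤ inside-part outside-part ⟩
  card (restrict inside 𝓗) + card (restrict outside 𝓗)
    ≡⟨ card-restrict 𝓗 ⟨
  card 𝓗 ∎
  where
  open ≤-Reasoning
  𝓐₁ 𝓐₀ 𝓑₁ 𝓑₀ : Family n
  𝓐₁ = restrict inside 𝓐
  𝓐₀ = restrict outside 𝓐
  𝓑₁ = restrict inside 𝓑
  𝓑₀ = restrict outside 𝓑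

  inside-part : card 𝓐₁ + card (𝓑₁ ∩F 𝓑₀) ≤ card (restrict inside 𝓗)
  inside-part = crossIntersecting₂-card≤ (restrict-hereditary inside her)
    (λ S → 𝓐⊆𝓗 (inside ∷ S))
    (λ S T∈ → 𝓑⊆𝓗 (inside ∷ S) (∧-conicalˡ _ _ T∈))
    (λ S T S∈ T∈ → Nonempty-drop (cross (inside ∷ S) (outside ∷ T) S∈ (∧-conicalʳ _ _ T∈)))

  outside-part : card 𝓐₀ + card (𝓑₁ ∪F 𝓑₀) ≤ card (restrict outside 𝓗)
  outside-part = crossIntersecting₂-card≤ (restrict-hereditary outside her)
    (λ S → 𝓐⊆𝓗 (outside ∷ S))
    (λ S T∈ → [ restrict-inside⊆outside her S ∘ 𝓑⊆𝓗 (inside ∷ S) , 𝓑⊆𝓗 (outside ∷ S) ]′ (∨-true⁻ T∈))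
    (λ S T S∈ T∈ → Nonempty-drop
      ([ cross (outside ∷ S) (inside ∷ T) S∈ , cross (outside ∷ S) (outside ∷ T) S∈ ]′ (∨-true⁻ T∈)))

⊃-wellFounded : ∀ {n} → WellFounded (_⊃_ {n})
⊃-wellFounded {n} =
  Subrelation.wellFounded ⊃⇒co-card< (On.wellFounded (λ S → n ∸ ∣ S ∣) <-wellFounded)
  where
  ⊃⇒co-card< : ∀ {T S : Subset n} → T ⊃ S → n ∸ ∣ T ∣ < n ∸ ∣ S ∣
  ⊃⇒co-card< {T} S⊂T = ∸-monoʳ-< (p⊂q⇒∣p∣<∣q∣ S⊂T) (∣p∣≤n T)

extendToBase : ∀ {n} (𝓗 : Family n) {S} → S ∈F 𝓗 → ∃ λ B → IsBase 𝓗 B × S ⊆ B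
extendToBase 𝓗 {S} = extend S (⊃-wellFounded S)
  where
  extend : ∀ S → Acc _⊃_ S → S ∈F 𝓗 → ∃ λ B → IsBase 𝓗 B × S ⊆ B
  extend S (acc larger) S∈ with anySubset? (λ T → (𝓗 T ≟ᵇ true) ×-dec (S ⊂? T))
  ... | yes (T , T∈ , S⊂T) with extend T (larger S⊂T) T∈
  ...   | B , B-base , T⊆B = B , B-base , ⊆-trans (p⊂q⇒p⊆q S⊂T) T⊆B
  extend S _ S∈ | no ∄T = S , (S∈ , maximal) , ⊆-refl
    where
    maximal : ∀ T → T ∈F 𝓗 → S ⊆ T → T ≡ S
    maximal T T∈ S⊆T = ⊆-antisym T⊆S S⊆T
      where
      T⊆S : T ⊆ S
      T⊆S {x} x∈T with x ∈ᵈ S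
      ... | yes x∈S = x∈S
      ... | no x∉S = ⊥-elim (∄T (T , T∈ , S⊆T , x , x∈T , x∉S))

InsertClosed : ∀ {n} → Fin n → Family n → Set
InsertClosed x 𝓗 = ∀ S → S ∈F 𝓗 → (S ∪ ⁅ x ⁆) ∈F 𝓗

inAllBases⇒insertClosed : ∀ {n} {𝓗 : Family n} {x} → Hereditary 𝓗 →
                          (∀ B → IsBase 𝓗 B → x ∈ B) → InsertClosed x 𝓗
inAllBases⇒insertClosed {𝓗 = 𝓗} {x} her x∈bases S S∈ with extendToBase 𝓗 S∈
... | B , B-base , S⊆B = her B (S ∪ ⁅ x ⁆) (proj₁ B-base) S∪⁅x⁆⊆B
  where
  S∪⁅x⁆⊆B : S ∪ ⁅ x ⁆ ⊆ B
  S∪⁅x⁆⊆B {y} y∈ = [ S⊆B , (λ y∈⁅x⁆ → subst (_∈ B) (sym (x∈⁅y⁆⇒x≡y x y∈⁅x⁆)) (x∈bases B B-base)) ]′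
                     (x∈p∪q⁻ S ⁅ x ⁆ y∈)

restrict-insertClosed : ∀ {n} b {x} {𝓗 : Family (suc n)} → InsertClosed (suc x) 𝓗 →
                        InsertClosed x (restrict b 𝓗)
restrict-insertClosed b {x} {𝓗} closed S S∈ =
  subst (λ c → 𝓗 (c ∷ S ∪ ⁅ x ⁆) ≡ true) (∨-identityʳ b) (closed (b ∷ S) S∈)

-- Adding x maps 𝓗 into the star at x, at most two-to-one.
insertClosed⇒card≤star+star : ∀ {n} x {𝓗 : Family n} → InsertClosed x 𝓗 →
                              card 𝓗 ≤ card (star 𝓗 x) + card (star 𝓗 x)
insertClosed⇒card≤star+star {suc n} zero {𝓗} closed = begin
  card 𝓗                              ≡⟨ card-restrict 𝓗 ⟩
  card (restrict inside 𝓗) + card (restrict outside 𝓗)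
    ≤⟨ +-mono-≤ (card-mono 𝓗₁⊆𝓢₁) (card-mono (λ S → 𝓗₁⊆𝓢₁ S ∘ 𝓗₀⊆𝓗₁ S)) ⟩
  s₁ + s₁                             ≤⟨ +-mono-≤ (m≤m+n s₁ s₀) (m≤m+n s₁ s₀) ⟩
  (s₁ + s₀) + (s₁ + s₀)               ≡⟨ cong₂ _+_ (card-restrict 𝓢) (card-restrict 𝓢) ⟨
  card 𝓢 + card 𝓢 ∎
  where
  open ≤-Reasoning
  𝓢 : Family (suc n)
  𝓢 = star 𝓗 zero
  s₁ s₀ : ℕ
  s₁ = card (restrict inside 𝓢)
  s₀ = card (restrict outside 𝓢)
  𝓗₁⊆𝓢₁ : restrict inside 𝓗 ⊆F restrict inside 𝓢
  𝓗₁⊆𝓢₁ S S∈ = trans (∧-identityʳ _) S∈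
  𝓗₀⊆𝓗₁ : restrict outside 𝓗 ⊆F restrict inside 𝓗
  𝓗₀⊆𝓗₁ S S∈ = subst (λ U → 𝓗 (inside ∷ U) ≡ true) (∪-identityʳ S) (closed (outside ∷ S) S∈)
insertClosed⇒card≤star+star {suc n} (suc x) {𝓗} closed = begin
  card 𝓗                              ≡⟨ card-restrict 𝓗 ⟩
  card 𝓗₁ + card 𝓗₀
    ≤⟨ +-mono-≤ (insertClosed⇒card≤star+star x (restrict-insertClosed inside closed))
                (insertClosed⇒card≤star+star x (restrict-insertClosed outside closed)) ⟩
  (s₁ + s₁) + (s₀ + s₀)               ≡⟨ +-interchange s₁ s₁ s₀ s₀ ⟩
  (s₁ + s₀) + (s₁ + s₀)               ≡⟨ cong₂ _+_ (card-restrict 𝓢) (card-restrict 𝓢) ⟨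
  card 𝓢 + card 𝓢 ∎
  where
  open ≤-Reasoning
  𝓗₁ 𝓗₀ : Family n
  𝓗₁ = restrict inside 𝓗
  𝓗₀ = restrict outside 𝓗
  𝓢 : Family (suc n)
  𝓢 = star 𝓗 (suc x)
  s₁ s₀ : ℕ
  s₁ = card (star 𝓗₁ x)
  s₀ = card (star 𝓗₀ x)

t<m⇒m+n≤t+t⇒n<t : ∀ {m n t} → t < m → m + n ≤ t + t → n < t
t<m⇒m+n≤t+t⇒n<t {m} {n} {t} t<m m+n≤t+t = +-cancelˡ-≤ t (suc n) t (begin
  t + suc n  ≡⟨ +-suc t n ⟩
  suc t + n  ≤⟨ +-monoˡ-≤ n t<m ⟩
  m + n      ≤⟨ m+n≤t+t ⟩
  t + t      ∎)
  where open ≤-Reasoning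

t<m⇒m+n≤t+t⇒m*n≤t*t : ∀ {m n t} → t < m → m + n ≤ t + t → m * n ≤ t * t
t<m⇒m+n≤t+t⇒m*n≤t*t {m} {n} {t} t<m m+n≤t+t = begin
  m * n          ≡⟨ cong (_* n) t+d≡m ⟨
  (t + d) * n    ≡⟨ *-distribʳ-+ n t d ⟩
  t * n + d * n  ≤⟨ +-monoʳ-≤ (t * n) (*-monoʳ-≤ d (<⇒≤ (t<m⇒m+n≤t+t⇒n<t t<m m+n≤t+t))) ⟩
  t * n + d * t  ≡⟨ cong (t * n +_) (*-comm d t) ⟩
  t * n + t * d  ≡⟨ *-distribˡ-+ t n d ⟨
  t * (n + d)    ≤⟨ *-monoʳ-≤ t n+d≤t ⟩
  t * t          ∎
  where
  open ≤-Reasoning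
  d : ℕ
  d = m ∸ t
  t+d≡m : t + d ≡ m
  t+d≡m = m+[n∸m]≡n (<⇒≤ t<m)
  n+d≤t : n + d ≤ t
  n+d≤t = +-cancelˡ-≤ t (n + d) t (begin
    t + (n + d)  ≡⟨ cong (t +_) (+-comm n d) ⟩
    t + (d + n)  ≡⟨ +-assoc t d n ⟨
    t + d + n    ≡⟨ cong (_+ n) t+d≡m ⟩
    m + n        ≤⟨ m+n≤t+t ⟩
    t + t        ∎)

m+n≤t+t⇒m*n≤t*t : ∀ {m n} t → m + n ≤ t + t → m * n ≤ t * t
m+n≤t+t⇒m*n≤t*t {m} {n} t m+n≤t+t with m ≤? t | n ≤? t
... | yes m≤t | yes n≤t = *-mono-≤ m≤t n≤t
... | no m≰t  | _       = t<m⇒m+n≤t+t⇒m*n≤t*t (≰⇒> m≰t) m+n≤t+t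
... | yes _   | no n≰t  = subst (_≤ t * t) (*-comm n m)
  (t<m⇒m+n≤t+t⇒m*n≤t*t (≰⇒> n≰t) (subst (_≤ t + t) (+-comm m n) m+n≤t+t))

sumFin-≤ : ∀ m {t} (a : Fin m → ℕ) → (∀ i → a i ≤ t) → sumFin m a ≤ m * t
sumFin-≤ zero    a a≤t = z≤n
sumFin-≤ (suc m) a a≤t = +-mono-≤ (a≤t zero) (sumFin-≤ m (a ∘ suc) (a≤t ∘ suc))

prodFin-≤ : ∀ m {t} (a : Fin m → ℕ) → (∀ i → a i ≤ t) → prodFin m a ≤ t ^ m
prodFin-≤ zero    a a≤t = ≤-refl
prodFin-≤ (suc m) a a≤t = *-mono-≤ (a≤t zero) (prodFin-≤ m (a ∘ suc) (a≤t ∘ suc))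

PairwiseSum≤ : ∀ {k} → ℕ → (Fin k → ℕ) → Set
PairwiseSum≤ t a = ∀ i j → i ≢ j → a i + a j ≤ t + t

PairwiseSum≤-tail : ∀ {k} t (a : Fin (suc k) → ℕ) → PairwiseSum≤ t a → PairwiseSum≤ t (a ∘ suc)
PairwiseSum≤-tail t a pairwise i j i≢j = pairwise (suc i) (suc j) (i≢j ∘ Fin.suc-injective)

PairwiseSum≤-head>⇒tail≤ : ∀ {k} t (a : Fin (suc k) → ℕ) → PairwiseSum≤ t a → t < a zero →
                           ∀ i → a (suc i) ≤ t
PairwiseSum≤-head>⇒tail≤ t a pairwise t<a₀ i = <⇒≤ (t<m⇒m+n≤t+t⇒n<t t<a₀ (pairwise zero (suc i) (λ ())))

sumFin≤-pair+rest : ∀ m t (a : Fin (suc (suc m)) → ℕ) → a zero + a (suc zero) ≤ t + t →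
                    (∀ i → a (suc (suc i)) ≤ t) → sumFin (suc (suc m)) a ≤ suc (suc m) * t
sumFin≤-pair+rest m t a pair≤ rest≤ = begin
  a zero + (a (suc zero) + rest)  ≡⟨ +-assoc (a zero) (a (suc zero)) rest ⟨
  (a zero + a (suc zero)) + rest  ≤⟨ +-mono-≤ pair≤ (sumFin-≤ m (λ i → a (suc (suc i))) rest≤) ⟩
  (t + t) + m * t                 ≡⟨ +-assoc t t (m * t) ⟩
  t + (t + m * t)                 ∎
  where
  open ≤-Reasoning
  rest : ℕ
  rest = sumFin m (λ i → a (suc (suc i)))

prodFin≤-pair*rest : ∀ m t (a : Fin (suc (suc m)) → ℕ) → a zero * a (suc zero) ≤ t * t →
                     (∀ i → a (suc (suc i)) ≤ t) → prodFin (suc (suc m)) a ≤ t ^ suc (suc m)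
prodFin≤-pair*rest m t a pair≤ rest≤ = begin
  a zero * (a (suc zero) * rest)  ≡⟨ *-assoc (a zero) (a (suc zero)) rest ⟨
  (a zero * a (suc zero)) * rest  ≤⟨ *-mono-≤ pair≤ (prodFin-≤ m (λ i → a (suc (suc i))) rest≤) ⟩
  (t * t) * t ^ m                 ≡⟨ *-assoc t t (t ^ m) ⟩
  t * (t * t ^ m)                 ∎
  where
  open ≤-Reasoning
  rest : ℕ
  rest = prodFin m (λ i → a (suc (suc i)))

-- If a₀ ≤ t we drop it; otherwise a₀ is the only entry above t.
pairwiseSum≤⇒sumFin≤ : ∀ m t (a : Fin (suc (suc m)) → ℕ) → PairwiseSum≤ t a →
                       sumFin (suc (suc m)) a ≤ suc (suc m) * t
pairwiseSum≤⇒sumFin≤ zero t a pairwise = sumFin≤-pair+rest zero t a (pairwise zero (suc zero) (λ ())) (λ ())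
pairwiseSum≤⇒sumFin≤ (suc m) t a pairwise with a zero ≤? t
... | yes a₀≤t = +-mono-≤ a₀≤t (pairwiseSum≤⇒sumFin≤ m t (a ∘ suc) (PairwiseSum≤-tail t a pairwise))
... | no a₀≰t  = sumFin≤-pair+rest (suc m) t a (pairwise zero (suc zero) (λ ()))
                   (PairwiseSum≤-head>⇒tail≤ t a pairwise (≰⇒> a₀≰t) ∘ suc)

pairwiseSum≤⇒prodFin≤ : ∀ m t (a : Fin (suc (suc m)) → ℕ) → PairwiseSum≤ t a →
                        prodFin (suc (suc m)) a ≤ t ^ suc (suc m)
pairwiseSum≤⇒prodFin≤ zero t a pairwise =
  prodFin≤-pair*rest zero t a (m+n≤t+t⇒m*n≤t*t {a zero} t (pairwise zero (suc zero) (λ ()))) (λ ())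
pairwiseSum≤⇒prodFin≤ (suc m) t a pairwise with a zero ≤? t
... | yes a₀≤t = *-mono-≤ a₀≤t (pairwiseSum≤⇒prodFin≤ m t (a ∘ suc) (PairwiseSum≤-tail t a pairwise))
... | no a₀≰t  = prodFin≤-pair*rest (suc m) t a (m+n≤t+t⇒m*n≤t*t {a zero} t (pairwise zero (suc zero) (λ ())))
                   (PairwiseSum≤-head>⇒tail≤ t a pairwise (≰⇒> a₀≰t) ∘ suc)

∈?≡true⇒∈ : ∀ {n} (y : Fin n) S → (y ∈? S) ≡ true → y ∈ S
∈?≡true⇒∈ zero    (inside ∷ S) _       = here
∈?≡true⇒∈ (suc y) (_ ∷ S)      y∈?S = there (∈?≡true⇒∈ y S y∈?S)

star-crossIntersecting : ∀ {n k} (𝓗 : Family n) y → CrossIntersecting {n} {k} (λ _ → star 𝓗 y)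
star-crossIntersecting 𝓗 y _ _ _ S T S∈ T∈ =
  y , x∈p∩q⁺ (∈?≡true⇒∈ y S (∧-conicalʳ _ _ S∈) , ∈?≡true⇒∈ y T (∧-conicalʳ _ _ T∈))

firstOnly-crossIntersecting : ∀ {n k} (𝓗 : Family n) → CrossIntersecting {n} {k} (firstOnly 𝓗)
firstOnly-crossIntersecting 𝓗 zero    zero    0≢0 _ _ _ _  = ⊥-elim (0≢0 refl)
firstOnly-crossIntersecting 𝓗 zero    (suc _) _   _ _ _ ()
firstOnly-crossIntersecting 𝓗 (suc _) _       _   _ _ () _

module _ {n} {𝓗 : Family n} (her : Hereditary 𝓗) {s} (𝓗≤s+s : card 𝓗 ≤ s + s) where

  crossIntersecting⇒pairwiseSum≤ : ∀ {k} (𝓐 : Fin k → Family n) → AllSub 𝓐 𝓗 → CrossIntersecting 𝓐 →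
                                   PairwiseSum≤ s (λ i → card (𝓐 i))
  crossIntersecting⇒pairwiseSum≤ 𝓐 𝓐⊆𝓗 cross i j i≢j =
    ≤-trans (crossIntersecting₂-card≤ her (𝓐⊆𝓗 i) (𝓐⊆𝓗 j) (cross i j i≢j)) 𝓗≤s+s

  crossIntersecting-sumFin≤ : ∀ {k} → 2 ≤ k → (𝓐 : Fin k → Family n) → AllSub 𝓐 𝓗 →
                              CrossIntersecting 𝓐 → sumFin k (λ i → card (𝓐 i)) ≤ k * s
  crossIntersecting-sumFin≤ {suc (suc m)} (s≤s (s≤s _)) 𝓐 𝓐⊆𝓗 cross =
    pairwiseSum≤⇒sumFin≤ m s (λ i → card (𝓐 i)) (crossIntersecting⇒pairwiseSum≤ 𝓐 𝓐⊆𝓗 cross)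

  crossIntersecting-prodFin≤ : ∀ {k} → 2 ≤ k → (𝓐 : Fin k → Family n) → AllSub 𝓐 𝓗 →
                               CrossIntersecting 𝓐 → prodFin k (λ i → card (𝓐 i)) ≤ s ^ k
  crossIntersecting-prodFin≤ {suc (suc m)} (s≤s (s≤s _)) 𝓐 𝓐⊆𝓗 cross =
    pairwiseSum≤⇒prodFin≤ m s (λ i → card (𝓐 i)) (crossIntersecting⇒pairwiseSum≤ 𝓐 𝓐⊆𝓗 cross)

  crossIntersecting-sumFin≤card⊔ : ∀ {k} → 1 ≤ k → (𝓐 : Fin k → Family n) → AllSub 𝓐 𝓗 →
                                   CrossIntersecting 𝓐 → sumFin k (λ i → card (𝓐 i)) ≤ card 𝓗 ⊔ k * s
  crossIntersecting-sumFin≤card⊔ {suc zero} _ 𝓐 𝓐⊆𝓗 _ = begin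
    card (𝓐 zero) + 0  ≡⟨ +-identityʳ _ ⟩
    card (𝓐 zero)      ≤⟨ card-mono (𝓐⊆𝓗 zero) ⟩
    card 𝓗             ≤⟨ m≤m⊔n _ _ ⟩
    card 𝓗 ⊔ 1 * s     ∎
    where open ≤-Reasoning
  crossIntersecting-sumFin≤card⊔ {suc (suc m)} _ 𝓐 𝓐⊆𝓗 cross =
    ≤-trans (crossIntersecting-sumFin≤ (s≤s (s≤s z≤n)) 𝓐 𝓐⊆𝓗 cross) (m≤n⊔m _ _)

corollary3p8 :
    (n : ℕ) → 1 ≤ n → (𝓗 : Family n) → NonemptyFam 𝓗 → Hereditary 𝓗 →
    (x : Fin n) → (∀ B → IsBase 𝓗 B → x ∈ B) →
    (y : Fin n) → IsLargestStar 𝓗 y →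
    ((k : ℕ) → n + 1 ≤ k →
      CrossIntersecting {n} {k} (λ _ → star 𝓗 y)
      × ((𝓐 : Fin k → Family n) → AllSub 𝓐 𝓗 → CrossIntersecting 𝓐 →
          sumFin k (λ i → card (𝓐 i)) ≤ k * card (star 𝓗 y)))
    ×
    ((k : ℕ) → 1 ≤ k →
      (k * card (star 𝓗 y) ≤ card 𝓗 →
        CrossIntersecting {n} {k} (firstOnly 𝓗)
        × ((𝓐 : Fin k → Family n) → AllSub 𝓐 𝓗 → CrossIntersecting 𝓐 →
            sumFin k (λ i → card (𝓐 i)) ≤ card 𝓗))
      ×
      (card 𝓗 ≤ k * card (star 𝓗 y) →
        CrossIntersecting {n} {k} (λ _ → star 𝓗 y)
        × ((𝓐 : Fin k → Family n) → AllSub 𝓐 𝓗 → CrossIntersecting 𝓐 →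
            sumFin k (λ i → card (𝓐 i)) ≤ k * card (star 𝓗 y))))
    ×
    ((k : ℕ) → 2 ≤ k →
      CrossIntersecting {n} {k} (λ _ → star 𝓗 y)
      × ((𝓐 : Fin k → Family n) → AllSub 𝓐 𝓗 → CrossIntersecting 𝓐 →
          prodFin k (λ i → card (𝓐 i)) ≤ card (star 𝓗 y) ^ k))
corollary3p8 n 1≤n 𝓗 _ her x x∈bases y largest =
    (λ k n+1≤k → star-crossIntersecting 𝓗 y , crossIntersecting-sumFin≤ her 𝓗≤s+s (≤-trans (+-monoˡ-≤ 1 1≤n) n+1≤k))
  , (λ k 1≤k →
      (λ ks≤𝓗 → firstOnly-crossIntersecting 𝓗 ,
        λ 𝓐 𝓐⊆𝓗 cross → ≤-trans (crossIntersecting-sumFin≤card⊔ her 𝓗≤s+s 1≤k 𝓐 𝓐⊆𝓗 cross) (≤-reflexive (m≥n⇒m⊔n≡m ks≤𝓗)))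
    , (λ 𝓗≤ks → star-crossIntersecting 𝓗 y ,
        λ 𝓐 𝓐⊆𝓗 cross → ≤-trans (crossIntersecting-sumFin≤card⊔ her 𝓗≤s+s 1≤k 𝓐 𝓐⊆𝓗 cross) (≤-reflexive (m≤n⇒m⊔n≡n 𝓗≤ks))))
  , (λ k 2≤k → star-crossIntersecting 𝓗 y , crossIntersecting-prodFin≤ her 𝓗≤s+s 2≤k)
  where
  𝓗≤s+s : card 𝓗 ≤ card (star 𝓗 y) + card (star 𝓗 y)
  𝓗≤s+s = ≤-trans (insertClosed⇒card≤star+star x (inAllBases⇒insertClosed her x∈bases))
                  (+-mono-≤ (largest x) (largest x))
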